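{- Let $p, r \ge 2$ be integers and let $c$ be a real constant with $0 < c \le 1$. Then there exists $n_0$ such that for every $n \ge n_0$ and every integer $e$ with $c\binom{n}{r} \le e \le \binom{n}{r}$, there exist a non-negative integer $k \le n$ and an $r$-graph on $k$ vertices with exactly $e$ edges which is the complement of a $p$-sparse $r$-graph (on the same $k$ vertices).
   Context: An $r$-graph is an $r$-uniform hypergraph. The complement of an $r$-graph $H$ on vertex set $V$ is the $r$-graph on $V$ whose edges are the $r$-subsets of $V$ that are not edges of $H$. An $r$-graph is called $p$-sparse if every set of $p$ of its vertices induces at most $p$ edges.
   Formalization: The constant c with $0 < c \le 1$ is taken over the rationals rather than the reals. -}

module Defs where

open import Data.Bool using (Bool; true; false; _∧_; not; if_then_else_)
open import Data.Nat using (ℕ; zero; suc; _≤_; _≡ᵇ_)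
open import Data.List using (List; []; _∷_; map; _++_; filter; length)
open import Data.Vec using (Vec; []; _∷_)
open import Data.Fin.Subset using (Subset; ∣_∣)
open import Relation.Binary.PropositionalEquality using (_≡_)
open import Relation.Nullary.Decidable using (does)
open import Relation.Nullary using (yes; no)
open import Data.Bool.Properties using (T?)
open import Data.Bool using (T)

allSubsets : (k : ℕ) → List (Subset k)
allSubsets zero = [] ∷ []
allSubsets (suc k) = map (true ∷_) (allSubsets k) ++ map (false ∷_) (allSubsets k)

_⊆ᵇ_ : ∀ {k} → Subset k → Subset k → Bool
[] ⊆ᵇ [] = true
(true ∷ t) ⊆ᵇ (false ∷ s) = false
(_ ∷ t) ⊆ᵇ (_ ∷ s) = t ⊆ᵇ s

record RGraph (r k : ℕ) : Set where
  field
    edge : Subset k → Bool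
    uniform : ∀ S → edge S ≡ true → ∣ S ∣ ≡ r
open RGraph public

countEdges : ∀ {k} → (Subset k → Bool) → ℕ
countEdges {k} P = length (filter (λ S → T? (P S)) (allSubsets k))

numEdges : ∀ {r k} → RGraph r k → ℕ
numEdges G = countEdges (edge G)

inducedEdges : ∀ {r k} → RGraph r k → Subset k → ℕ
inducedEdges G S = countEdges (λ T → edge G T ∧ (T ⊆ᵇ S))

Sparse : ∀ {r k} → ℕ → RGraph r k → Set
Sparse {r} {k} p G = ∀ (S : Subset k) → ∣ S ∣ ≡ p → inducedEdges G S ≤ p

complement : ∀ {r k} → RGraph r k → RGraph r k
complement {r} G = record
  { edge = λ S → (∣ S ∣ ≡ᵇ r) ∧ not (edge G S)
  ; uniform = λ S eq → lem S eq }
  where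
  open import Data.Nat.Properties using (≡ᵇ⇒≡)
  lem : ∀ S → ((∣ S ∣ ≡ᵇ r) ∧ not (edge G S)) ≡ true → ∣ S ∣ ≡ r
  lem S eq with ∣ S ∣ ≡ᵇ r in h
  ... | true = ≡ᵇ⇒≡ _ _ (subst T (sym h) tt)
    where open import Relation.Binary.PropositionalEquality using (subst; sym)
          open import Data.Unit using (tt)
  lem S () | false

{-# OPTIONS --safe #-}
-- Let k be least with e ≤ C(k,r) and d = C(k,r) − e; as e > C(k−1,r), d ≤ C(k−1,r−1) = (r/k)·C(k,r).
-- It suffices to find a p-sparse r-graph on k vertices with exactly d edges: its complement has e.
-- Among the C(N,d) families of d of the N = C(k,r) r-sets, count the triples (family, p-set S, p + 1
-- members of the family inside S). There are C(k,p)·C(C(p,r),p+1)·C(N−p−1,d−p−1) of them, at most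
-- C(N,d)·C(C(p,r),p+1)·k^p·(d/N)^(p+1) ≤ C(N,d)·C(C(p,r),p+1)·r^(p+1)/k, which is below C(N,d) once k
-- exceeds C(C(p,r),p+1)·r^(p+1); some family then occurs in no triple, i.e. is p-sparse. Finally
-- c·C(n,r) ≤ e forces e, and with it k, beyond this threshold for all large n.
module Submission where

open import Defs

-- A module of its own, so that ℕ's _*_ opened inside it does not clash with ℚ's _*_ in the statement.
module SparseComplements where

  open import Function using (_∘_)
  open import Level using (Level)
  open import Data.Bool using (Bool; true; false; _∧_; not)
  open import Data.Bool.Properties using (T?; T-≡; ∧-comm; ∧-identityʳ; ∧-zeroʳ)
  open import Function.Bundles using (Equivalence)
  open import Data.Nat
  open import Data.Nat.Properties
  open import Data.Nat.Combinatorics using (_C_; nCn≡1; nCk≡nC[n∸k]; k>n⇒nCk≡0; nCk+nC[k+1]≡[n+1]C[k+1])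
  open import Data.Nat.Tactic.RingSolver using (solve-∀)
  open import Data.Integer as ℤ using (+0; -[1+_]; +<+)
  open import Data.Integer.Properties using (pos-*; drop‿+≤+)
  import Data.Rational as ℚ
  open import Data.Rational.Properties using (toℚᵘ-mono-≤; toℚᵘ-homo-*; toℚᵘ-fromℚᵘ)
  import Data.Rational.Unnormalised as ℚᵘ
  open ℚᵘ using (mkℚᵘ)
  open import Data.Rational.Unnormalised.Properties using (≤-respˡ-≃; ≤-respʳ-≃; *-congˡ)
  open import Data.List as List using (List; []; _∷_; map; filter; length)
  import Data.List.Membership.Propositional as List
  open import Data.List.Membership.Propositional.Properties using (∈-map⁺; ∈-++⁺ˡ; ∈-++⁺ʳ)
  open import Data.List.Relation.Unary.Any using (here; there)
  open import Data.Vec using ([]; _∷_; lookup; _++_; splitAt)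
  open import Data.Vec.Properties using (lookup-++ˡ; lookup-++ʳ; zipWith-++)
  open import Data.Fin using (Fin; zero; _↑ˡ_; _↑ʳ_)
  open import Data.Fin.Subset using (Subset; ∣_∣; ⊥; ⊤; _∩_)
  open import Data.Fin.Subset.Properties using (∣⊥∣≡0; ∣⊤∣≡n)
  open import Data.Product using (∃; Σ; _×_; _,_; proj₁; proj₂)
  open import Relation.Binary.PropositionalEquality
  open import Relation.Nullary using (yes; no; contradiction)

  -- Pascal's recursion, which computes by pattern matching; the library's _C_ is defined by division.
  infixl 8 _choose_

  _choose_ : ℕ → ℕ → ℕ
  n     choose zero  = 1
  zero  choose suc k = 0
  suc n choose suc k = n choose k + n choose suc k

  choose≡C : ∀ n k → n choose k ≡ n C k
  choose≡C n       zero    = sym (trans (nCk≡nC[n∸k] {0} {n} z≤n) (nCn≡1 n))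
  choose≡C zero    (suc k) = sym (k>n⇒nCk≡0 {0} {suc k} z<s)
  choose≡C (suc n) (suc k) =
    trans (cong₂ _+_ (choose≡C n k) (choose≡C n (suc k))) (nCk+nC[k+1]≡[n+1]C[k+1] n k)

  choose-< : ∀ {n k} → n < k → n choose k ≡ 0
  choose-< {zero}  {suc k} _         = refl
  choose-< {suc n} {suc k} (s<s n<k) = cong₂ _+_ (choose-< n<k) (choose-< (m<n⇒m<1+n n<k))

  choose-diag : ∀ n → n choose n ≡ 1
  choose-diag zero    = refl
  choose-diag (suc n) = cong₂ _+_ (choose-diag n) (choose-< (n<1+n n))

  choose>0 : ∀ {n k} → k ≤ n → 0 < n choose k
  choose>0 {k = zero}  _         = z<s
  choose>0 {suc n} {suc k} (s≤s k≤n) = ≤-trans (choose>0 k≤n) (m≤m+n _ _)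

  choose>0⇒≤ : ∀ {n k} → 0 < n choose k → k ≤ n
  choose>0⇒≤ {n} {k} 0<nCk with k ≤? n
  ... | yes k≤n = k≤n
  ... | no  k≰n = contradiction (choose-< (≰⇒> k≰n)) (>⇒≢ 0<nCk)

  choose-1 : ∀ n → n choose 1 ≡ n
  choose-1 zero    = refl
  choose-1 (suc n) = cong suc (choose-1 n)

  choose-monoˡ-≤ : ∀ {m n} k → m ≤ n → m choose k ≤ n choose k
  choose-monoˡ-≤ zero    _         = ≤-refl
  choose-monoˡ-≤ (suc k) z≤n       = z≤n
  choose-monoˡ-≤ (suc k) (s≤s m≤n) = +-mono-≤ (choose-monoˡ-≤ k m≤n) (choose-monoˡ-≤ (suc k) m≤n)

  choose-absorption : ∀ n k → suc n choose suc k * suc k ≡ suc n * n choose k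
  choose-absorption zero    zero    = refl
  choose-absorption zero    (suc k) = refl
  choose-absorption (suc n) zero    rewrite choose-1 n = refl
  choose-absorption (suc n) (suc k) = begin
      (x + y) * suc (suc k)                    ≡⟨ distrib x y k ⟩
      x * suc k + x + y * suc (suc k)          ≡⟨ cong₂ (λ u v → u + x + v) (choose-absorption n k) (choose-absorption n (suc k)) ⟩
      suc n * a + (a + b) + suc n * b          ≡⟨ collect n a b ⟩
      suc (suc n) * (a + b)                    ∎
    where
    open ≡-Reasoning
    x = suc n choose suc k
    y = suc n choose suc (suc k)
    a = n choose k
    b = n choose suc k
    distrib : ∀ x y k → (x + y) * suc (suc k) ≡ x * suc k + x + y * suc (suc k)
    distrib = solve-∀
    collect : ∀ n a b → suc n * a + (a + b) + suc n * b ≡ suc (suc n) * (a + b)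
    collect = solve-∀

  choose≤^ : ∀ n k → n choose k ≤ n ^ k
  choose≤^ n       zero    = ≤-refl
  choose≤^ zero    (suc k) = z≤n
  choose≤^ (suc n) (suc k) = *-cancelʳ-≤ _ _ (suc k) (begin
    suc n choose suc k * suc k  ≡⟨ choose-absorption n k ⟩
    suc n * n choose k          ≤⟨ *-monoʳ-≤ (suc n) (≤-trans (choose≤^ n k) (^-monoˡ-≤ k (n≤1+n n))) ⟩
    suc n ^ suc k               ≤⟨ m≤m*n (suc n ^ suc k) (suc k) ⟩
    suc n ^ suc k * suc k       ∎)
    where open ≤-Reasoning

  <-choose-+ : ∀ m {r} → 0 < r → m < (m + r) choose r
  <-choose-+ zero    {suc r} _   = ≤-reflexive (sym (choose-diag (suc r)))
  <-choose-+ (suc m) {suc r} 0<r = +-mono-≤ (choose>0 (≤-trans (n≤1+n r) (m≤n+m (suc r) m))) (<-choose-+ m 0<r)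

  ^-distribʳ-* : ∀ m n k → (m * n) ^ k ≡ m ^ k * n ^ k
  ^-distribʳ-* m n zero    = refl
  ^-distribʳ-* m n (suc k) = trans (cong (m * n *_) (^-distribʳ-* m n k)) (swap m n (m ^ k) (n ^ k))
    where
    swap : ∀ m n x y → m * n * (x * y) ≡ m * x * (n * y)
    swap = solve-∀

  -- The number C(a − b, M − b) of M-subsets of an a-set containing a given b-subset (0 when M < b).
  supersetCount : ℕ → ℕ → ℕ → ℕ
  supersetCount a       zero    M       = a choose M
  supersetCount zero    (suc b) M       = 0
  supersetCount (suc a) (suc b) zero    = 0
  supersetCount (suc a) (suc b) (suc M) = supersetCount a b M

  supersetCount-zero : ∀ a b → supersetCount a (suc b) 0 ≡ 0
  supersetCount-zero zero    b = refl
  supersetCount-zero (suc a) b = refl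

  supersetCount-suc-zero : ∀ a b → supersetCount (suc a) b 0 ≡ supersetCount a b 0
  supersetCount-suc-zero a       zero    = refl
  supersetCount-suc-zero zero    (suc b) = refl
  supersetCount-suc-zero (suc a) (suc b) = refl

  supersetCount-pascal : ∀ a b M → b ≤ a →
    supersetCount (suc a) b (suc M) ≡ supersetCount a b M + supersetCount a b (suc M)
  supersetCount-pascal a       zero    M       _         = refl
  supersetCount-pascal (suc a) (suc b) zero    (s≤s b≤a) = supersetCount-suc-zero a b
  supersetCount-pascal (suc a) (suc b) (suc M) (s≤s b≤a) = supersetCount-pascal a b M b≤a

  -- (a + 1) / a ≤ (M + 1) / M because M ≤ a.
  ^-shift : ∀ {a M} x y b .{{_ : NonZero M}} → M ≤ a →
            x * a ^ b ≤ y * M ^ b → x * suc a ^ b ≤ y * suc M ^ b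
  ^-shift {a} {M} x y b M≤a xa≤yM = *-cancelʳ-≤ _ _ (M ^ b) {{m^n≢0 M b}} (begin
    x * suc a ^ b * M ^ b   ≡⟨ regroup x (suc a ^ b) (M ^ b) ⟩
    x * (suc a ^ b * M ^ b) ≡⟨ cong (x *_) (^-distribʳ-* (suc a) M b) ⟨
    x * (suc a * M) ^ b     ≤⟨ *-monoʳ-≤ x (^-monoˡ-≤ b cross) ⟩
    x * (suc M * a) ^ b     ≡⟨ cong (x *_) (^-distribʳ-* (suc M) a b) ⟩
    x * (suc M ^ b * a ^ b) ≡⟨ swap x (suc M ^ b) (a ^ b) ⟩
    x * a ^ b * suc M ^ b   ≤⟨ *-monoˡ-≤ (suc M ^ b) xa≤yM ⟩
    y * M ^ b * suc M ^ b   ≡⟨ swap′ y (M ^ b) (suc M ^ b) ⟩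
    y * suc M ^ b * M ^ b   ∎)
    where
    open ≤-Reasoning
    cross : suc a * M ≤ suc M * a
    cross = subst (suc a * M ≤_) (cong (a +_) (*-comm a M)) (+-monoˡ-≤ (a * M) M≤a)
    regroup : ∀ x y z → x * y * z ≡ x * (y * z)
    regroup = solve-∀
    swap : ∀ x y z → x * (y * z) ≡ x * z * y
    swap = solve-∀
    swap′ : ∀ x y z → x * y * z ≡ x * z * y
    swap′ = solve-∀

  supersetCount-bound : ∀ a b M → M ≤ a → supersetCount a b M * a ^ b ≤ a choose M * M ^ b
  supersetCount-bound a       zero    M       _         = ≤-refl
  supersetCount-bound zero    (suc b) M       _         = z≤n
  supersetCount-bound (suc a) (suc b) zero    _         = z≤n
  supersetCount-bound (suc a) (suc b) (suc M) (s≤s M≤a) = begin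
    supersetCount a b M * (suc a * suc a ^ b)   ≡⟨ rotate (supersetCount a b M) (suc a) (suc a ^ b) ⟩
    suc a * (supersetCount a b M * suc a ^ b)   ≤⟨ *-monoʳ-≤ (suc a) (shifted b M M≤a) ⟩
    suc a * (a choose M * suc M ^ b)            ≡⟨ *-assoc (suc a) (a choose M) _ ⟨
    suc a * a choose M * suc M ^ b              ≡⟨ cong (_* suc M ^ b) (choose-absorption a M) ⟨
    suc a choose suc M * suc M * suc M ^ b      ≡⟨ *-assoc (suc a choose suc M) (suc M) _ ⟩
    suc a choose suc M * (suc M * suc M ^ b)    ∎
    where
    open ≤-Reasoning
    rotate : ∀ x y z → x * (y * z) ≡ y * (x * z)
    rotate = solve-∀
    shifted : ∀ b M → M ≤ a → supersetCount a b M * suc a ^ b ≤ a choose M * suc M ^ b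
    shifted zero    M       _   = ≤-refl
    shifted (suc b) zero    _   rewrite supersetCount-zero a b = z≤n
    shifted (suc b) (suc M) M≤a =
      ^-shift (supersetCount a (suc b) (suc M)) (a choose suc M) (suc b) M≤a (supersetCount-bound a (suc b) (suc M) M≤a)

  private variable
    ℓ ℓ′ : Level
    X : Set ℓ
    Y : Set ℓ′

  𝟙 : Bool → ℕ
  𝟙 true  = 1
  𝟙 false = 0

  𝟙-∧ : ∀ a b → 𝟙 (a ∧ b) ≡ 𝟙 a * 𝟙 b
  𝟙-∧ true  true  = refl
  𝟙-∧ true  false = refl
  𝟙-∧ false _     = refl

  ∑ : List X → (X → ℕ) → ℕ
  ∑ []       f = 0
  ∑ (x ∷ xs) f = f x + ∑ xs f

  infixr 5 ∑
  syntax ∑ xs (λ x → e) = ∑[ x ∈ xs ] e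

  ∑-cong : ∀ (xs : List X) {f g : X → ℕ} → (∀ x → f x ≡ g x) → ∑ xs f ≡ ∑ xs g
  ∑-cong []       _   = refl
  ∑-cong (x ∷ xs) f≗g = cong₂ _+_ (f≗g x) (∑-cong xs f≗g)

  ∑-zero : ∀ (xs : List X) {f : X → ℕ} → (∀ x → f x ≡ 0) → ∑ xs f ≡ 0
  ∑-zero []       _    = refl
  ∑-zero (x ∷ xs) f≗0 = cong₂ _+_ (f≗0 x) (∑-zero xs f≗0)

  ∑-*ˡ : ∀ (xs : List X) (c : ℕ) (f : X → ℕ) → ∑[ x ∈ xs ] c * f x ≡ c * (∑[ x ∈ xs ] f x)
  ∑-*ˡ []       c f = sym (*-zeroʳ c)
  ∑-*ˡ (x ∷ xs) c f = trans (cong (c * f x +_) (∑-*ˡ xs c f)) (sym (*-distribˡ-+ c (f x) _))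

  ∑-*ʳ : ∀ (xs : List X) (c : ℕ) (f : X → ℕ) → ∑[ x ∈ xs ] f x * c ≡ (∑[ x ∈ xs ] f x) * c
  ∑-*ʳ xs c f = trans (∑-cong xs (λ x → *-comm (f x) c)) (trans (∑-*ˡ xs c f) (*-comm c _))

  ∑-+ : ∀ (xs : List X) (f g : X → ℕ) → ∑[ x ∈ xs ] (f x + g x) ≡ (∑[ x ∈ xs ] f x) + (∑[ x ∈ xs ] g x)
  ∑-+ []       f g = refl
  ∑-+ (x ∷ xs) f g = trans (cong (f x + g x +_) (∑-+ xs f g)) (+-interchange (f x) (g x) _ _)
    where
    +-interchange : ∀ a b c d → a + b + (c + d) ≡ a + c + (b + d)
    +-interchange = solve-∀

  ∑-swap : (xs : List X) (ys : List Y) (f : X → Y → ℕ) →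
           ∑[ x ∈ xs ] ∑[ y ∈ ys ] f x y ≡ ∑[ y ∈ ys ] ∑[ x ∈ xs ] f x y
  ∑-swap []       ys f = sym (∑-zero ys (λ _ → refl))
  ∑-swap (x ∷ xs) ys f =
    trans (cong (∑ ys (f x) +_) (∑-swap xs ys f)) (sym (∑-+ ys (f x) (λ y → ∑[ x ∈ xs ] f x y)))

  ∑-++ : ∀ (xs ys : List X) (f : X → ℕ) → ∑ (xs List.++ ys) f ≡ ∑ xs f + ∑ ys f
  ∑-++ []       ys f = refl
  ∑-++ (x ∷ xs) ys f = trans (cong (f x +_) (∑-++ xs ys f)) (sym (+-assoc (f x) _ _))

  ∑-map : (g : Y → X) (ys : List Y) (f : X → ℕ) → ∑ (map g ys) f ≡ ∑[ y ∈ ys ] f (g y)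
  ∑-map g []       f = refl
  ∑-map g (y ∷ ys) f = cong (f (g y) +_) (∑-map g ys f)

  ∈⇒≤∑ : ∀ {xs : List X} {x} (f : X → ℕ) → x List.∈ xs → f x ≤ ∑ xs f
  ∈⇒≤∑ f (here refl) = m≤m+n _ _
  ∈⇒≤∑ f (there x∈xs) = ≤-trans (∈⇒≤∑ f x∈xs) (m≤n+m _ _)

  length-filter≡∑𝟙 : ∀ (xs : List X) (P : X → Bool) → length (filter (λ x → T? (P x)) xs) ≡ ∑[ x ∈ xs ] 𝟙 (P x)
  length-filter≡∑𝟙 []       P = refl
  length-filter≡∑𝟙 (x ∷ xs) P with P x
  ... | true  = cong suc (length-filter≡∑𝟙 xs P)
  ... | false = length-filter≡∑𝟙 xs P

  mean<1⇒∃≡0 : ∀ (xs : List X) (v : X → Bool) (f : X → ℕ) →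
               ∑[ x ∈ xs ] 𝟙 (v x) * f x < ∑[ x ∈ xs ] 𝟙 (v x) → ∃ λ x → v x ≡ true × f x ≡ 0
  mean<1⇒∃≡0 (x ∷ xs) v f lt with v x in vx | f x in fx
  ... | false | _     = mean<1⇒∃≡0 xs v f lt
  ... | true  | zero  = x , vx , fx
  ... | true  | suc m = mean<1⇒∃≡0 xs v f (≤-trans (s≤s (m≤n+m _ _)) (≤-pred lt))

  ∈-allSubsets : ∀ {n} (S : Subset n) → S List.∈ allSubsets n
  ∈-allSubsets []          = here refl
  ∈-allSubsets (true ∷ S)  = ∈-++⁺ˡ (∈-map⁺ (true ∷_) (∈-allSubsets S))
  ∈-allSubsets (false ∷ S) = ∈-++⁺ʳ (map (true ∷_) (allSubsets _)) (∈-map⁺ (false ∷_) (∈-allSubsets S))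

  ∑-allSubsets-suc : ∀ n (f : Subset (suc n) → ℕ) →
    ∑ (allSubsets (suc n)) f ≡ (∑[ A ∈ allSubsets n ] f (true ∷ A)) + (∑[ A ∈ allSubsets n ] f (false ∷ A))
  ∑-allSubsets-suc n f = trans (∑-++ (map (true ∷_) (allSubsets n)) _ f)
    (cong₂ _+_ (∑-map (true ∷_) (allSubsets n) f) (∑-map (false ∷_) (allSubsets n) f))

  ⊥⊆ᵇ : ∀ {n} (X : Subset n) → ⊥ ⊆ᵇ X ≡ true
  ⊥⊆ᵇ []          = refl
  ⊥⊆ᵇ (true ∷ X)  = ⊥⊆ᵇ X
  ⊥⊆ᵇ (false ∷ X) = ⊥⊆ᵇ X

  ⊆ᵇ⊤ : ∀ {n} (X : Subset n) → X ⊆ᵇ ⊤ ≡ true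
  ⊆ᵇ⊤ []          = refl
  ⊆ᵇ⊤ (true ∷ X)  = ⊆ᵇ⊤ X
  ⊆ᵇ⊤ (false ∷ X) = ⊆ᵇ⊤ X

  ⊆ᵇ-∩ : ∀ {n} (B X Y : Subset n) → B ⊆ᵇ (X ∩ Y) ≡ B ⊆ᵇ X ∧ B ⊆ᵇ Y
  ⊆ᵇ-∩ []          []          []          = refl
  ⊆ᵇ-∩ (true ∷ B)  (true ∷ X)  (true ∷ Y)  = ⊆ᵇ-∩ B X Y
  ⊆ᵇ-∩ (true ∷ B)  (true ∷ X)  (false ∷ Y) = sym (∧-zeroʳ _)
  ⊆ᵇ-∩ (true ∷ B)  (false ∷ X) (y ∷ Y)     = refl
  ⊆ᵇ-∩ (false ∷ B) (true ∷ X)  (y ∷ Y)     = ⊆ᵇ-∩ B X Y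
  ⊆ᵇ-∩ (false ∷ B) (false ∷ X) (y ∷ Y)     = ⊆ᵇ-∩ B X Y

  ⊆ᵇ-trans : ∀ {n} (X Y Z : Subset n) → X ⊆ᵇ Y ≡ true → Y ⊆ᵇ Z ≡ true → X ⊆ᵇ Z ≡ true
  ⊆ᵇ-trans []          []          []          _   _   = refl
  ⊆ᵇ-trans (true ∷ X)  (true ∷ Y)  (true ∷ Z)  X⊆Y Y⊆Z = ⊆ᵇ-trans X Y Z X⊆Y Y⊆Z
  ⊆ᵇ-trans (false ∷ X) (true ∷ Y)  (true ∷ Z)  X⊆Y Y⊆Z = ⊆ᵇ-trans X Y Z X⊆Y Y⊆Z
  ⊆ᵇ-trans (false ∷ X) (false ∷ Y) (z ∷ Z)     X⊆Y Y⊆Z = ⊆ᵇ-trans X Y Z X⊆Y Y⊆Z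
  ⊆ᵇ-trans (true ∷ X)  (false ∷ Y) _           ()  _
  ⊆ᵇ-trans _           (true ∷ Y)  (false ∷ Z) _   ()

  ⊆ᵇ⇒∣∣≤ : ∀ {n} (B U : Subset n) → B ⊆ᵇ U ≡ true → ∣ B ∣ ≤ ∣ U ∣
  ⊆ᵇ⇒∣∣≤ []          []          _   = z≤n
  ⊆ᵇ⇒∣∣≤ (true ∷ B)  (true ∷ U)  B⊆U = s≤s (⊆ᵇ⇒∣∣≤ B U B⊆U)
  ⊆ᵇ⇒∣∣≤ (false ∷ B) (true ∷ U)  B⊆U = m≤n⇒m≤1+n (⊆ᵇ⇒∣∣≤ B U B⊆U)
  ⊆ᵇ⇒∣∣≤ (false ∷ B) (false ∷ U) B⊆U = ⊆ᵇ⇒∣∣≤ B U B⊆U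
  ⊆ᵇ⇒∣∣≤ (true ∷ B)  (false ∷ U) ()

  ∧∧-zeroʳ : ∀ x y → x ∧ y ∧ false ≡ false
  ∧∧-zeroʳ x y = trans (cong (x ∧_) (∧-zeroʳ y)) (∧-zeroʳ x)

  count-between : ∀ {n} (B U : Subset n) M → B ⊆ᵇ U ≡ true →
    ∑[ A ∈ allSubsets n ] 𝟙 (B ⊆ᵇ A ∧ A ⊆ᵇ U ∧ (∣ A ∣ ≡ᵇ M)) ≡ supersetCount ∣ U ∣ ∣ B ∣ M
  count-between [] [] zero    _ = refl
  count-between [] [] (suc M) _ = refl
  count-between {suc n} (true ∷ B) (true ∷ U) zero B⊆U = trans (∑-allSubsets-suc n _)
    (cong₂ _+_ (∑-zero (allSubsets n) λ A → cong 𝟙 (∧∧-zeroʳ (B ⊆ᵇ A) (A ⊆ᵇ U)))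
               (∑-zero (allSubsets n) λ _ → refl))
  count-between {suc n} (true ∷ B) (true ∷ U) (suc M) B⊆U = trans (∑-allSubsets-suc n _)
    (trans (cong₂ _+_ (count-between B U M B⊆U) (∑-zero (allSubsets n) λ _ → refl)) (+-identityʳ _))
  count-between {suc n} (false ∷ B) (true ∷ U) zero B⊆U = trans (∑-allSubsets-suc n _)
    (trans (cong₂ _+_ (∑-zero (allSubsets n) λ A → cong 𝟙 (∧∧-zeroʳ (B ⊆ᵇ A) (A ⊆ᵇ U)))
                      (count-between B U zero B⊆U))
           (sym (supersetCount-suc-zero ∣ U ∣ ∣ B ∣)))
  count-between {suc n} (false ∷ B) (true ∷ U) (suc M) B⊆U = trans (∑-allSubsets-suc n _)
    (trans (cong₂ _+_ (count-between B U M B⊆U) (count-between B U (suc M) B⊆U))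
           (sym (supersetCount-pascal ∣ U ∣ ∣ B ∣ M (⊆ᵇ⇒∣∣≤ B U B⊆U))))
  count-between {suc n} (false ∷ B) (false ∷ U) M B⊆U = trans (∑-allSubsets-suc n _)
    (cong₂ _+_ (∑-zero (allSubsets n) λ A → cong 𝟙 (∧-zeroʳ (B ⊆ᵇ A))) (count-between B U M B⊆U))
  count-between (true ∷ B) (false ∷ U) M ()

  count-subsets : ∀ {n} (U : Subset n) M → ∑[ A ∈ allSubsets n ] 𝟙 (A ⊆ᵇ U ∧ (∣ A ∣ ≡ᵇ M)) ≡ ∣ U ∣ choose M
  count-subsets {n} U M = begin
    ∑[ A ∈ allSubsets n ] 𝟙 (A ⊆ᵇ U ∧ (∣ A ∣ ≡ᵇ M))
      ≡⟨ ∑-cong (allSubsets n) (λ A → cong (λ b → 𝟙 (b ∧ A ⊆ᵇ U ∧ (∣ A ∣ ≡ᵇ M))) (⊥⊆ᵇ A)) ⟨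
    ∑[ A ∈ allSubsets n ] 𝟙 (⊥ ⊆ᵇ A ∧ A ⊆ᵇ U ∧ (∣ A ∣ ≡ᵇ M))
      ≡⟨ count-between ⊥ U M (⊥⊆ᵇ U) ⟩
    supersetCount ∣ U ∣ ∣ ⊥ {n} ∣ M
      ≡⟨ cong (λ b → supersetCount ∣ U ∣ b M) (∣⊥∣≡0 n) ⟩
    ∣ U ∣ choose M
      ∎
    where open ≡-Reasoning

  count-ofSize : ∀ n M → ∑[ A ∈ allSubsets n ] 𝟙 (∣ A ∣ ≡ᵇ M) ≡ n choose M
  count-ofSize n M = begin
    ∑[ A ∈ allSubsets n ] 𝟙 (∣ A ∣ ≡ᵇ M)
      ≡⟨ ∑-cong (allSubsets n) (λ A → cong (λ b → 𝟙 (b ∧ (∣ A ∣ ≡ᵇ M))) (⊆ᵇ⊤ A)) ⟨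
    ∑[ A ∈ allSubsets n ] 𝟙 (A ⊆ᵇ ⊤ ∧ (∣ A ∣ ≡ᵇ M))
      ≡⟨ count-subsets (⊤ {n}) M ⟩
    ∣ ⊤ {n} ∣ choose M
      ≡⟨ cong (_choose M) (∣⊤∣≡n n) ⟩
    n choose M
      ∎
    where open ≡-Reasoning

  ∧≡true⇒× : ∀ {a b} → a ∧ b ≡ true → a ≡ true × b ≡ true
  ∧≡true⇒× {true} {true} _ = refl , refl

  ≡ᵇ-true⇒≡ : ∀ {m n} → (m ≡ᵇ n) ≡ true → m ≡ n
  ≡ᵇ-true⇒≡ {m} {n} eq = ≡ᵇ⇒≡ m n (Equivalence.from T-≡ eq)

  ≡⇒≡ᵇ-true : ∀ {m n} → m ≡ n → (m ≡ᵇ n) ≡ true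
  ≡⇒≡ᵇ-true {m} {n} eq = Equivalence.to T-≡ (≡⇒≡ᵇ m n eq)

  𝟙-regroup : ∀ a m b x j → 𝟙 (a ∧ m) * 𝟙 ((b ∧ x) ∧ j) ≡ 𝟙 (x ∧ j) * 𝟙 (b ∧ a ∧ m)
  𝟙-regroup a m b x j
    rewrite 𝟙-∧ a m | 𝟙-∧ (b ∧ x) j | 𝟙-∧ b x | 𝟙-∧ x j | 𝟙-∧ b (a ∧ m) | 𝟙-∧ a m =
    regroup (𝟙 a) (𝟙 m) (𝟙 b) (𝟙 x) (𝟙 j)
    where
    regroup : ∀ a m b x j → a * m * (b * x * j) ≡ x * j * (b * (a * m))
    regroup = solve-∀

  ∑-choose-∣∩∣ : ∀ {n} (U X : Subset n) j d → X ⊆ᵇ U ≡ true →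
    ∑[ A ∈ allSubsets n ] 𝟙 (A ⊆ᵇ U ∧ (∣ A ∣ ≡ᵇ d)) * ∣ A ∩ X ∣ choose j ≡ ∣ X ∣ choose j * supersetCount ∣ U ∣ j d
  ∑-choose-∣∩∣ {n} U X j d X⊆U = begin
    ∑[ A ∈ 𝒫 ] 𝟙 (A ⊆ᵇ U ∧ (∣ A ∣ ≡ᵇ d)) * ∣ A ∩ X ∣ choose j
      ≡⟨ ∑-cong 𝒫 (λ A → cong (𝟙 (A ⊆ᵇ U ∧ (∣ A ∣ ≡ᵇ d)) *_) (count-subsets (A ∩ X) j)) ⟨
    ∑[ A ∈ 𝒫 ] 𝟙 (A ⊆ᵇ U ∧ (∣ A ∣ ≡ᵇ d)) * (∑[ B ∈ 𝒫 ] 𝟙 (B ⊆ᵇ (A ∩ X) ∧ (∣ B ∣ ≡ᵇ j)))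
      ≡⟨ ∑-cong 𝒫 (λ A → trans (∑-cong 𝒫 (pair A)) (∑-*ˡ 𝒫 (𝟙 (A ⊆ᵇ U ∧ (∣ A ∣ ≡ᵇ d))) _)) ⟨
    ∑[ A ∈ 𝒫 ] ∑[ B ∈ 𝒫 ] 𝟙 (B ⊆ᵇ X ∧ (∣ B ∣ ≡ᵇ j)) * 𝟙 (B ⊆ᵇ A ∧ A ⊆ᵇ U ∧ (∣ A ∣ ≡ᵇ d))
      ≡⟨ ∑-swap 𝒫 𝒫 _ ⟩
    ∑[ B ∈ 𝒫 ] ∑[ A ∈ 𝒫 ] 𝟙 (B ⊆ᵇ X ∧ (∣ B ∣ ≡ᵇ j)) * 𝟙 (B ⊆ᵇ A ∧ A ⊆ᵇ U ∧ (∣ A ∣ ≡ᵇ d))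
      ≡⟨ ∑-cong 𝒫 (λ B → trans (∑-*ˡ 𝒫 (𝟙 (B ⊆ᵇ X ∧ (∣ B ∣ ≡ᵇ j))) _) (supersets B)) ⟩
    ∑[ B ∈ 𝒫 ] 𝟙 (B ⊆ᵇ X ∧ (∣ B ∣ ≡ᵇ j)) * g
      ≡⟨ ∑-*ʳ 𝒫 g _ ⟩
    (∑[ B ∈ 𝒫 ] 𝟙 (B ⊆ᵇ X ∧ (∣ B ∣ ≡ᵇ j))) * g
      ≡⟨ cong (_* g) (count-subsets X j) ⟩
    ∣ X ∣ choose j * g
      ∎
    where
    open ≡-Reasoning
    𝒫 = allSubsets n
    g = supersetCount ∣ U ∣ j d
    pair : ∀ A B → 𝟙 (B ⊆ᵇ X ∧ (∣ B ∣ ≡ᵇ j)) * 𝟙 (B ⊆ᵇ A ∧ A ⊆ᵇ U ∧ (∣ A ∣ ≡ᵇ d))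
                 ≡ 𝟙 (A ⊆ᵇ U ∧ (∣ A ∣ ≡ᵇ d)) * 𝟙 (B ⊆ᵇ (A ∩ X) ∧ (∣ B ∣ ≡ᵇ j))
    pair A B rewrite ⊆ᵇ-∩ B A X = sym (𝟙-regroup (A ⊆ᵇ U) (∣ A ∣ ≡ᵇ d) (B ⊆ᵇ A) (B ⊆ᵇ X) (∣ B ∣ ≡ᵇ j))
    supersets : ∀ B → 𝟙 (B ⊆ᵇ X ∧ (∣ B ∣ ≡ᵇ j)) * (∑[ A ∈ 𝒫 ] 𝟙 (B ⊆ᵇ A ∧ A ⊆ᵇ U ∧ (∣ A ∣ ≡ᵇ d)))
                    ≡ 𝟙 (B ⊆ᵇ X ∧ (∣ B ∣ ≡ᵇ j)) * g
    supersets B with B ⊆ᵇ X in B⊆X | ∣ B ∣ ≡ᵇ j in ∣B∣≡j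
    ... | false | _     = refl
    ... | true  | false = refl
    ... | true  | true  = cong (_+ 0) (trans (count-between B U d (⊆ᵇ-trans B X U B⊆X X⊆U))
                                             (cong (λ b → supersetCount ∣ U ∣ b d) (≡ᵇ-true⇒≡ {∣ B ∣} {j} ∣B∣≡j)))

  powersetSize : ℕ → ℕ
  powersetSize zero    = 1
  powersetSize (suc k) = powersetSize k + powersetSize k

  -- A family of subsets of Fin k is a subset of Fin (2 ^ k), its members listed in the order of
  -- allSubsets k, so that families are counted by the same lemmas as subsets.
  Family : ℕ → Set
  Family k = Subset (powersetSize k)

  tabulateFamily : ∀ {k} → (Subset k → Bool) → Family k
  tabulateFamily {zero}  f = f [] ∷ []
  tabulateFamily {suc k} f = tabulateFamily {k} (f ∘ (true ∷_)) ++ tabulateFamily {k} (f ∘ (false ∷_))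

  position : ∀ {k} → Subset k → Fin (powersetSize k)
  position []                  = zero
  position {suc k} (true ∷ S)  = position S ↑ˡ powersetSize k
  position {suc k} (false ∷ S) = powersetSize k ↑ʳ position S

  infix 7 _∈ᶠ_

  _∈ᶠ_ : ∀ {k} → Subset k → Family k → Bool
  S ∈ᶠ 𝒜 = lookup 𝒜 (position S)

  tabulate-cong : ∀ {k} {f g : Subset k → Bool} → (∀ S → f S ≡ g S) → tabulateFamily f ≡ tabulateFamily g
  tabulate-cong {zero}  f≗g = cong (_∷ []) (f≗g [])
  tabulate-cong {suc k} f≗g = cong₂ _++_ (tabulate-cong {k} (f≗g ∘ (true ∷_))) (tabulate-cong {k} (f≗g ∘ (false ∷_)))

  tabulate-∈ᶠ : ∀ {k} (𝒜 : Family k) → tabulateFamily {k} (_∈ᶠ 𝒜) ≡ 𝒜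
  tabulate-∈ᶠ {zero}  (b ∷ []) = refl
  tabulate-∈ᶠ {suc k} 𝒜 with splitAt (powersetSize k) 𝒜
  ... | 𝒜₁ , 𝒜₀ , refl = cong₂ _++_
    (trans (tabulate-cong {k} (λ S → lookup-++ˡ 𝒜₁ 𝒜₀ (position S))) (tabulate-∈ᶠ {k} 𝒜₁))
    (trans (tabulate-cong {k} (λ S → lookup-++ʳ 𝒜₁ 𝒜₀ (position S))) (tabulate-∈ᶠ {k} 𝒜₀))

  tabulate-∧ : ∀ {k} (f g : Subset k → Bool) → tabulateFamily (λ S → f S ∧ g S) ≡ tabulateFamily {k} f ∩ tabulateFamily {k} g
  tabulate-∧ {zero}  f g = refl
  tabulate-∧ {suc k} f g = trans (cong₂ _++_ (tabulate-∧ {k} _ _) (tabulate-∧ {k} _ _))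
    (sym (zipWith-++ _∧_ (tabulateFamily {k} (f ∘ (true ∷_))) (tabulateFamily {k} (f ∘ (false ∷_)))
                         (tabulateFamily {k} (g ∘ (true ∷_))) (tabulateFamily {k} (g ∘ (false ∷_)))))

  ∣++∣ : ∀ {m n} (xs : Subset m) (ys : Subset n) → ∣ xs ++ ys ∣ ≡ ∣ xs ∣ + ∣ ys ∣
  ∣++∣ []          ys = refl
  ∣++∣ (true ∷ xs)  ys = cong suc (∣++∣ xs ys)
  ∣++∣ (false ∷ xs) ys = ∣++∣ xs ys

  ∣tabulate∣ : ∀ {k} (f : Subset k → Bool) → ∣ tabulateFamily f ∣ ≡ ∑[ S ∈ allSubsets k ] 𝟙 (f S)
  ∣tabulate∣ {zero}  f with f []
  ... | true  = refl
  ... | false = refl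
  ∣tabulate∣ {suc k} f = begin
    ∣ tabulateFamily {k} (f ∘ (true ∷_)) ++ tabulateFamily {k} (f ∘ (false ∷_)) ∣
      ≡⟨ ∣++∣ (tabulateFamily {k} (f ∘ (true ∷_))) _ ⟩
    ∣ tabulateFamily {k} (f ∘ (true ∷_)) ∣ + ∣ tabulateFamily {k} (f ∘ (false ∷_)) ∣
      ≡⟨ cong₂ _+_ (∣tabulate∣ {k} _) (∣tabulate∣ {k} _) ⟩
    (∑[ S ∈ allSubsets k ] 𝟙 (f (true ∷ S))) + (∑[ S ∈ allSubsets k ] 𝟙 (f (false ∷ S)))
      ≡⟨ ∑-allSubsets-suc k (𝟙 ∘ f) ⟨
    ∑[ S ∈ allSubsets (suc k) ] 𝟙 (f S)
      ∎
    where open ≡-Reasoning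

  countEdges≡∑𝟙 : ∀ {k} (f : Subset k → Bool) → countEdges f ≡ ∑[ S ∈ allSubsets k ] 𝟙 (f S)
  countEdges≡∑𝟙 {k} f = length-filter≡∑𝟙 (allSubsets k) f

  countEdges≡∣tabulate∣ : ∀ {k} (f : Subset k → Bool) → countEdges f ≡ ∣ tabulateFamily f ∣
  countEdges≡∣tabulate∣ f = trans (countEdges≡∑𝟙 f) (sym (∣tabulate∣ f))

  ⊆ᵇ-++ : ∀ {m n} (xs xs′ : Subset m) (ys ys′ : Subset n) → (xs ++ ys) ⊆ᵇ (xs′ ++ ys′) ≡ xs ⊆ᵇ xs′ ∧ ys ⊆ᵇ ys′
  ⊆ᵇ-++ []           []           ys ys′ = refl
  ⊆ᵇ-++ (true ∷ xs)  (true ∷ xs′)  ys ys′ = ⊆ᵇ-++ xs xs′ ys ys′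
  ⊆ᵇ-++ (true ∷ xs)  (false ∷ xs′) ys ys′ = refl
  ⊆ᵇ-++ (false ∷ xs) (x′ ∷ xs′)    ys ys′ = ⊆ᵇ-++ xs xs′ ys ys′

  tabulate-⊆ᵇ : ∀ {k} {f g : Subset k → Bool} → (∀ S → f S ≡ true → g S ≡ true) →
                tabulateFamily f ⊆ᵇ tabulateFamily g ≡ true
  tabulate-⊆ᵇ {zero} {f} f⇒g with f [] in f[]
  ... | false = refl
  ... | true  rewrite f⇒g [] f[] = refl
  tabulate-⊆ᵇ {suc k} {f} {g} f⇒g =
    trans (⊆ᵇ-++ (tabulateFamily {k} (f ∘ (true ∷_))) (tabulateFamily {k} (g ∘ (true ∷_))) _ _)
          (cong₂ _∧_ (tabulate-⊆ᵇ {k} (f⇒g ∘ (true ∷_))) (tabulate-⊆ᵇ {k} (f⇒g ∘ (false ∷_))))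

  ⊆ᵇ⇒∩≡ : ∀ {n} (A X : Subset n) → A ⊆ᵇ X ≡ true → A ∩ X ≡ A
  ⊆ᵇ⇒∩≡ []          []          _   = refl
  ⊆ᵇ⇒∩≡ (true ∷ A)  (true ∷ X)  A⊆X = cong (true ∷_) (⊆ᵇ⇒∩≡ A X A⊆X)
  ⊆ᵇ⇒∩≡ (false ∷ A) (x ∷ X)     A⊆X = cong (false ∷_) (⊆ᵇ⇒∩≡ A X A⊆X)
  ⊆ᵇ⇒∩≡ (true ∷ A)  (false ∷ X) ()

  ≡ᵇ∧⇒≡ : ∀ {m n} b → (m ≡ᵇ n) ∧ b ≡ true → m ≡ n
  ≡ᵇ∧⇒≡ {m} {n} b eq with m ≡ᵇ n in m≡ᵇn
  ... | true = ≡ᵇ-true⇒≡ m≡ᵇn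

  rSetsIn : ∀ {k} → ℕ → Subset k → Family k
  rSetsIn r S = tabulateFamily (λ T → (∣ T ∣ ≡ᵇ r) ∧ T ⊆ᵇ S)

  ∣rSetsIn∣ : ∀ {k} r (S : Subset k) → ∣ rSetsIn r S ∣ ≡ ∣ S ∣ choose r
  ∣rSetsIn∣ {k} r S = trans (∣tabulate∣ (λ T → (∣ T ∣ ≡ᵇ r) ∧ T ⊆ᵇ S))
    (trans (∑-cong (allSubsets k) (λ T → cong 𝟙 (∧-comm (∣ T ∣ ≡ᵇ r) (T ⊆ᵇ S)))) (count-subsets S r))

  rSets : ∀ k r → Family k
  rSets k r = rSetsIn r (⊤ {k})

  ∣rSets∣ : ∀ k r → ∣ rSets k r ∣ ≡ k choose r
  ∣rSets∣ k r = trans (∣rSetsIn∣ r (⊤ {k})) (cong (_choose r) (∣⊤∣≡n k))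

  rSetsIn-⊆ᵇ-rSets : ∀ {k} r (S : Subset k) → rSetsIn r S ⊆ᵇ rSets k r ≡ true
  rSetsIn-⊆ᵇ-rSets {k} r S = tabulate-⊆ᵇ {k} {λ T → (∣ T ∣ ≡ᵇ r) ∧ T ⊆ᵇ S} {λ T → (∣ T ∣ ≡ᵇ r) ∧ T ⊆ᵇ ⊤}
    (λ T T∈ → trans (cong ((∣ T ∣ ≡ᵇ r) ∧_) (⊆ᵇ⊤ T)) (trans (∧-identityʳ _) (proj₁ (∧≡true⇒× T∈))))

  graphOf : ∀ {k} r → Family k → RGraph r k
  graphOf r 𝒜 = record { edge = λ S → (∣ S ∣ ≡ᵇ r) ∧ S ∈ᶠ 𝒜 ; uniform = λ S → ≡ᵇ∧⇒≡ (S ∈ᶠ 𝒜) }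

  inducedEdges-graphOf : ∀ {k} r (𝒜 : Family k) (S : Subset k) →
                         inducedEdges (graphOf r 𝒜) S ≡ ∣ 𝒜 ∩ rSetsIn r S ∣
  inducedEdges-graphOf {k} r 𝒜 S = begin
    countEdges (λ T → ((∣ T ∣ ≡ᵇ r) ∧ T ∈ᶠ 𝒜) ∧ T ⊆ᵇ S)
      ≡⟨ countEdges≡∣tabulate∣ {k} _ ⟩
    ∣ tabulateFamily (λ T → ((∣ T ∣ ≡ᵇ r) ∧ T ∈ᶠ 𝒜) ∧ T ⊆ᵇ S) ∣
      ≡⟨ cong ∣_∣ (tabulate-cong {k} λ T → rotate (∣ T ∣ ≡ᵇ r) (T ∈ᶠ 𝒜) (T ⊆ᵇ S)) ⟩
    ∣ tabulateFamily (λ T → T ∈ᶠ 𝒜 ∧ (∣ T ∣ ≡ᵇ r) ∧ T ⊆ᵇ S) ∣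
      ≡⟨ cong ∣_∣ (tabulate-∧ {k} (_∈ᶠ 𝒜) _) ⟩
    ∣ tabulateFamily {k} (_∈ᶠ 𝒜) ∩ rSetsIn r S ∣
      ≡⟨ cong (λ 𝒜′ → ∣ 𝒜′ ∩ rSetsIn r S ∣) (tabulate-∈ᶠ {k} 𝒜) ⟩
    ∣ 𝒜 ∩ rSetsIn r S ∣
      ∎
    where
    open ≡-Reasoning
    rotate : ∀ a b c → (a ∧ b) ∧ c ≡ b ∧ a ∧ c
    rotate true  b c = refl
    rotate false b c = sym (∧-zeroʳ b)

  numEdges≡inducedEdges-⊤ : ∀ {r k} (G : RGraph r k) → numEdges G ≡ inducedEdges G ⊤
  numEdges≡inducedEdges-⊤ {k = k} G = trans (countEdges≡∑𝟙 (edge G)) (trans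
    (∑-cong (allSubsets k) (λ S → cong 𝟙 (sym (trans (cong (edge G S ∧_) (⊆ᵇ⊤ S)) (∧-identityʳ (edge G S))))))
    (sym (countEdges≡∑𝟙 (λ T → edge G T ∧ T ⊆ᵇ ⊤))))

  numEdges-graphOf : ∀ {k} r (𝒜 : Family k) → 𝒜 ⊆ᵇ rSets k r ≡ true → numEdges (graphOf {k} r 𝒜) ≡ ∣ 𝒜 ∣
  numEdges-graphOf {k} r 𝒜 𝒜⊆ = trans (numEdges≡inducedEdges-⊤ (graphOf {k} r 𝒜))
    (trans (inducedEdges-graphOf r 𝒜 (⊤ {k})) (cong ∣_∣ (⊆ᵇ⇒∩≡ 𝒜 (rSets k r) 𝒜⊆)))

  numEdges-complement : ∀ {r k} (G : RGraph r k) → numEdges (complement G) + numEdges G ≡ k choose r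
  numEdges-complement {r} {k} G = begin
    countEdges (edge (complement G)) + countEdges (edge G)
      ≡⟨ cong₂ _+_ (countEdges≡∑𝟙 (edge (complement G))) (countEdges≡∑𝟙 (edge G)) ⟩
    (∑[ S ∈ allSubsets k ] 𝟙 ((∣ S ∣ ≡ᵇ r) ∧ not (edge G S))) + (∑[ S ∈ allSubsets k ] 𝟙 (edge G S))
      ≡⟨ ∑-+ (allSubsets k) _ _ ⟨
    ∑[ S ∈ allSubsets k ] (𝟙 ((∣ S ∣ ≡ᵇ r) ∧ not (edge G S)) + 𝟙 (edge G S))
      ≡⟨ ∑-cong (allSubsets k) split ⟩
    ∑[ S ∈ allSubsets k ] 𝟙 (∣ S ∣ ≡ᵇ r)
      ≡⟨ count-ofSize k r ⟩
    k choose r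
      ∎
    where
    open ≡-Reasoning
    split : ∀ S → 𝟙 ((∣ S ∣ ≡ᵇ r) ∧ not (edge G S)) + 𝟙 (edge G S) ≡ 𝟙 (∣ S ∣ ≡ᵇ r)
    split S with edge G S in GS
    ... | false = trans (+-identityʳ _) (cong 𝟙 (∧-identityʳ _))
    ... | true  rewrite ∧-zeroʳ (∣ S ∣ ≡ᵇ r) | ≡⇒≡ᵇ-true (uniform G S GS) = refl

  overfull : ∀ {r k} → ℕ → RGraph r k → ℕ
  overfull {k = k} p G = ∑[ S ∈ allSubsets k ] 𝟙 (∣ S ∣ ≡ᵇ p) * inducedEdges G S choose suc p

  overfull≡0⇒Sparse : ∀ {r k} p (G : RGraph r k) → overfull p G ≡ 0 → Sparse p G
  overfull≡0⇒Sparse {k = k} p G none S ∣S∣≡p with inducedEdges G S ≤? p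
  ... | yes ≤p = ≤p
  ... | no  ≰p = contradiction none (>⇒≢ (≤-trans term>0 (∈⇒≤∑ term (∈-allSubsets S))))
    where
    term : Subset k → ℕ
    term T = 𝟙 (∣ T ∣ ≡ᵇ p) * inducedEdges G T choose suc p
    term>0 : 0 < term S
    term>0 rewrite ≡⇒≡ᵇ-true ∣S∣≡p | +-identityʳ (inducedEdges G S choose suc p) = choose>0 (≰⇒> ≰p)

  ∑-overfull : ∀ k r p d →
    ∑[ 𝒜 ∈ allSubsets (powersetSize k) ] 𝟙 (𝒜 ⊆ᵇ rSets k r ∧ (∣ 𝒜 ∣ ≡ᵇ d)) * overfull p (graphOf {k} r 𝒜)
      ≡ k choose p * (p choose r choose suc p * supersetCount (k choose r) (suc p) d)
  ∑-overfull k r p d = begin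
    ∑[ 𝒜 ∈ 𝔉 ] valid 𝒜 * (∑[ S ∈ 𝒫 ] 𝟙 (∣ S ∣ ≡ᵇ p) * inducedEdges (graphOf {k} r 𝒜) S choose j)
      ≡⟨ ∑-cong 𝔉 (λ 𝒜 → trans (∑-cong 𝒫 (swap-factors 𝒜)) (∑-*ˡ 𝒫 (valid 𝒜) _)) ⟨
    ∑[ 𝒜 ∈ 𝔉 ] ∑[ S ∈ 𝒫 ] 𝟙 (∣ S ∣ ≡ᵇ p) * (valid 𝒜 * ∣ 𝒜 ∩ rSetsIn r S ∣ choose j)
      ≡⟨ ∑-swap 𝔉 𝒫 _ ⟩
    ∑[ S ∈ 𝒫 ] ∑[ 𝒜 ∈ 𝔉 ] 𝟙 (∣ S ∣ ≡ᵇ p) * (valid 𝒜 * ∣ 𝒜 ∩ rSetsIn r S ∣ choose j)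
      ≡⟨ ∑-cong 𝒫 (λ S → trans (∑-*ˡ 𝔉 (𝟙 (∣ S ∣ ≡ᵇ p)) _)
                        (cong (𝟙 (∣ S ∣ ≡ᵇ p) *_) (∑-choose-∣∩∣ (rSets k r) (rSetsIn r S) j d (rSetsIn-⊆ᵇ-rSets r S)))) ⟩
    ∑[ S ∈ 𝒫 ] 𝟙 (∣ S ∣ ≡ᵇ p) * (∣ rSetsIn r S ∣ choose j * supersetCount ∣ rSets k r ∣ j d)
      ≡⟨ ∑-cong 𝒫 count-per-p-set ⟩
    ∑[ S ∈ 𝒫 ] 𝟙 (∣ S ∣ ≡ᵇ p) * (Q * g)
      ≡⟨ ∑-*ʳ 𝒫 (Q * g) _ ⟩
    (∑[ S ∈ 𝒫 ] 𝟙 (∣ S ∣ ≡ᵇ p)) * (Q * g)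
      ≡⟨ cong (_* (Q * g)) (count-ofSize k p) ⟩
    k choose p * (Q * g)
      ∎
    where
    open ≡-Reasoning
    j = suc p
    𝒫 = allSubsets k
    𝔉 = allSubsets (powersetSize k)
    Q = p choose r choose j
    g = supersetCount (k choose r) j d
    valid : Family k → ℕ
    valid 𝒜 = 𝟙 (𝒜 ⊆ᵇ rSets k r ∧ (∣ 𝒜 ∣ ≡ᵇ d))
    swap-factors : ∀ 𝒜 S → 𝟙 (∣ S ∣ ≡ᵇ p) * (valid 𝒜 * ∣ 𝒜 ∩ rSetsIn r S ∣ choose j)
                         ≡ valid 𝒜 * (𝟙 (∣ S ∣ ≡ᵇ p) * inducedEdges (graphOf {k} r 𝒜) S choose j)
    swap-factors 𝒜 S = trans (*-comm-middle (𝟙 (∣ S ∣ ≡ᵇ p)) (valid 𝒜) _)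
      (cong (λ e → valid 𝒜 * (𝟙 (∣ S ∣ ≡ᵇ p) * e choose j)) (sym (inducedEdges-graphOf {k} r 𝒜 S)))
      where
      *-comm-middle : ∀ a b c → a * (b * c) ≡ b * (a * c)
      *-comm-middle = solve-∀
    count-per-p-set : ∀ S → 𝟙 (∣ S ∣ ≡ᵇ p) * (∣ rSetsIn r S ∣ choose j * supersetCount ∣ rSets k r ∣ j d)
                          ≡ 𝟙 (∣ S ∣ ≡ᵇ p) * (Q * g)
    count-per-p-set S with ∣ S ∣ ≡ᵇ p in ∣S∣≡p
    ... | false = refl
    ... | true  = cong (_+ 0) (cong₂ (λ a b → a choose j * supersetCount b j d)
                    (trans (∣rSetsIn∣ r S) (cong (_choose r) (≡ᵇ-true⇒≡ ∣S∣≡p)))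
                    (∣rSets∣ k r))

  first-moment-bound : ∀ {c Q g X N d r k p} → c ≤ k ^ p → g * N ^ suc p ≤ X * d ^ suc p → d * k ≤ r * N →
                       Q * r ^ suc p < k → 0 < N → 0 < X → c * (Q * g) < X
  first-moment-bound {c} {Q} {g} {X} {N} {d} {r} {k} {p} c≤kᵖ gNʲ≤Xdʲ dk≤rN Qrʲ<k 0<N 0<X =
    *-cancelʳ-< ((N * k) ^ j) (c * (Q * g)) X (begin-strict
      c * (Q * g) * (N * k) ^ j     ≡⟨ cong (c * (Q * g) *_) (^-distribʳ-* N k j) ⟩
      c * (Q * g) * (Nʲ * kʲ)       ≡⟨ e₁ c Q g Nʲ kʲ ⟩
      c * Q * kʲ * (g * Nʲ)         ≤⟨ *-mono-≤ (*-monoˡ-≤ kʲ (*-monoˡ-≤ Q c≤kᵖ)) gNʲ≤Xdʲ ⟩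
      kᵖ * Q * kʲ * (X * dʲ)        ≡⟨ e₂ kᵖ Q kʲ X dʲ ⟩
      X * kᵖ * Q * (dʲ * kʲ)        ≡⟨ cong (X * kᵖ * Q *_) (^-distribʳ-* d k j) ⟨
      X * kᵖ * Q * (d * k) ^ j      ≤⟨ *-monoʳ-≤ (X * kᵖ * Q) (^-monoˡ-≤ j dk≤rN) ⟩
      X * kᵖ * Q * (r * N) ^ j      ≡⟨ cong (X * kᵖ * Q *_) (^-distribʳ-* r N j) ⟩
      X * kᵖ * Q * (rʲ * Nʲ)        ≡⟨ e₃ X kᵖ Q rʲ Nʲ ⟩
      X * Nʲ * kᵖ * (Q * rʲ)        <⟨ *-monoʳ-< (X * Nʲ * kᵖ) {{>-nonZero 0<XNʲkᵖ}} Qrʲ<k ⟩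
      X * Nʲ * kᵖ * k               ≡⟨ e₄ X Nʲ kᵖ k ⟩
      X * (Nʲ * kʲ)                 ≡⟨ cong (X *_) (^-distribʳ-* N k j) ⟨
      X * (N * k) ^ j               ∎)
    where
    open ≤-Reasoning
    j = suc p
    Nʲ = N ^ j
    kʲ = k ^ j
    kᵖ = k ^ p
    dʲ = d ^ j
    rʲ = r ^ j
    0<k : 0 < k
    0<k = ≤-<-trans z≤n Qrʲ<k
    0<XNʲkᵖ : 0 < X * Nʲ * kᵖ
    0<XNʲkᵖ = *-mono-< (*-mono-< 0<X (m^n>0 N {{>-nonZero 0<N}} j)) (m^n>0 k {{>-nonZero 0<k}} p)
    e₁ : ∀ c Q g Nʲ kʲ → c * (Q * g) * (Nʲ * kʲ) ≡ c * Q * kʲ * (g * Nʲ)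
    e₁ = solve-∀
    e₂ : ∀ kᵖ Q kʲ X dʲ → kᵖ * Q * kʲ * (X * dʲ) ≡ X * kᵖ * Q * (dʲ * kʲ)
    e₂ = solve-∀
    e₃ : ∀ X kᵖ Q rʲ Nʲ → X * kᵖ * Q * (rʲ * Nʲ) ≡ X * Nʲ * kᵖ * (Q * rʲ)
    e₃ = solve-∀
    e₄ : ∀ X Nʲ kᵖ k → X * Nʲ * kᵖ * k ≡ X * (Nʲ * (k * kᵖ))
    e₄ = solve-∀

  sparseThreshold : ℕ → ℕ → ℕ
  sparseThreshold p r = p choose r choose suc p * r ^ suc p

  sparse-graph-exists : ∀ {k r p d} → r ≤ k → sparseThreshold p r < k → d * k ≤ r * k choose r →
                        Σ (RGraph r k) λ G → Sparse p G × numEdges G ≡ d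
  sparse-graph-exists {k} {r} {p} {d} r≤k threshold<k dk≤rN =
    from-good-family (mean<1⇒∃≡0 𝔉 valid (λ 𝒜 → overfull p (graphOf {k} r 𝒜)) expected<total)
    where
    𝔉 = allSubsets (powersetSize k)
    N = k choose r
    valid : Family k → Bool
    valid 𝒜 = 𝒜 ⊆ᵇ rSets k r ∧ (∣ 𝒜 ∣ ≡ᵇ d)
    0<k : 0 < k
    0<k = ≤-<-trans z≤n threshold<k
    d≤N : d ≤ N
    d≤N = *-cancelʳ-≤ d N k {{>-nonZero 0<k}} (≤-trans dk≤rN (≤-trans (*-monoˡ-≤ N r≤k) (≤-reflexive (*-comm k N))))
    total : ∑[ 𝒜 ∈ 𝔉 ] 𝟙 (valid 𝒜) ≡ N choose d
    total = trans (count-subsets (rSets k r) d) (cong (_choose d) (∣rSets∣ k r))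
    expected<total : ∑[ 𝒜 ∈ 𝔉 ] 𝟙 (valid 𝒜) * overfull p (graphOf {k} r 𝒜) < ∑[ 𝒜 ∈ 𝔉 ] 𝟙 (valid 𝒜)
    expected<total = subst₂ _<_ (sym (∑-overfull k r p d)) (sym total)
      (first-moment-bound {Q = p choose r choose suc p} {g = supersetCount N (suc p) d} {d = d} {r = r} {p = p}
                          (choose≤^ k p) (supersetCount-bound N (suc p) d d≤N) dk≤rN threshold<k
                          (choose>0 r≤k) (choose>0 d≤N))
    from-good-family : (∃ λ 𝒜 → valid 𝒜 ≡ true × overfull p (graphOf {k} r 𝒜) ≡ 0) →
                    Σ (RGraph r k) λ G → Sparse p G × numEdges G ≡ d
    from-good-family (𝒜 , valid𝒜 , overfull≡0) =
      graphOf {k} r 𝒜 , overfull≡0⇒Sparse p (graphOf {k} r 𝒜) overfull≡0 ,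
      trans (numEdges-graphOf {k} r 𝒜 (proj₁ (∧≡true⇒× valid𝒜))) (≡ᵇ-true⇒≡ (proj₂ (∧≡true⇒× valid𝒜)))

  positive⇒bounded-inverse : ∀ (c : ℚ.ℚ) → ℚ.0ℚ ℚ.< c →
                             ∃ λ D → ∀ m e → c ℚ.* (ℤ.+ m ℚ./ 1) ℚ.≤ (ℤ.+ e ℚ./ 1) → m ≤ e * D
  positive⇒bounded-inverse c@(ℚ.mkℚ (ℤ.+ suc a) D-1 _) _ = suc D-1 , λ m e cm≤e →
    bound m e (≤-respʳ-≃ (toℚᵘ-fromℚᵘ (mkℚᵘ (ℤ.+ e) 0))
              (≤-respˡ-≃ (*-congˡ {ℚ.toℚᵘ c} (toℚᵘ-fromℚᵘ (mkℚᵘ (ℤ.+ m) 0)))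
              (≤-respˡ-≃ (toℚᵘ-homo-* c (ℤ.+ m ℚ./ 1)) (toℚᵘ-mono-≤ cm≤e))))
    where
    bound : ∀ m e → mkℚᵘ (ℤ.+ suc a) D-1 ℚᵘ.* mkℚᵘ (ℤ.+ m) 0 ℚᵘ.≤ mkℚᵘ (ℤ.+ e) 0 → m ≤ e * suc D-1
    bound m e (ℚᵘ.*≤* am≤eD) = ≤-trans (m≤n*m m (suc a))
      (subst₂ _≤_ (*-identityʳ _) (cong (e *_) (*-identityʳ (suc D-1)))
        (drop‿+≤+ (subst₂ ℤ._≤_ (trans (cong (ℤ._* ℤ.+ 1) (sym (pos-* (suc a) m))) (sym (pos-* (suc a * m) 1)))
                                  (sym (pos-* e _)) am≤eD)))
  positive⇒bounded-inverse (ℚ.mkℚ +0       _ _) (ℚ.*<* (+<+ ()))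
  positive⇒bounded-inverse (ℚ.mkℚ -[1+ _ ] _ _) (ℚ.*<* ())

  crossing-point : ∀ (f : ℕ → ℕ) {e} n → f 0 < e → e ≤ f n → ∃ λ k → k < n × f k < e × e ≤ f (suc k)
  crossing-point f zero    f0<e e≤f0 = contradiction (<-≤-trans f0<e e≤f0) (<-irrefl refl)
  crossing-point f {e} (suc n) f0<e e≤f[1+n] with e ≤? f n
  ... | no  e≰fn = n , n<1+n n , ≰⇒> e≰fn , e≤f[1+n]
  ... | yes e≤fn with crossing-point f n f0<e e≤fn
  ...   | k , k<n , below , above = k , m<n⇒m<1+n k<n , below , above

  sparse-complement-exists : ∀ p r {n e} → 0 < r → sparseThreshold p r choose r < e → e ≤ n choose r →
    ∃ λ k → k ≤ n × Σ (RGraph r k) λ G → Sparse p G × numEdges (complement G) ≡ e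
  sparse-complement-exists p r@(suc r′) {n} {e} _ Kᶜ<e e≤nᶜ =
    at-crossing (crossing-point (_choose r) n (≤-<-trans z≤n Kᶜ<e) e≤nᶜ)
    where
    K = sparseThreshold p r
    at-crossing : (∃ λ k′ → k′ < n × k′ choose r < e × e ≤ suc k′ choose r) →
                  ∃ λ k → k ≤ n × Σ (RGraph r k) λ G → Sparse p G × numEdges (complement G) ≡ e
    at-crossing (k′ , k′<n , below , above) = k , k′<n , G , proj₁ (proj₂ sparse-G) , complement-edges
      where
      k = suc k′
      d = k choose r ∸ e
      r≤k : r ≤ k
      r≤k = choose>0⇒≤ (<-≤-trans (≤-<-trans z≤n below) above)
      K<k : K < k
      K<k with k ≤? K
      ... | yes k≤K = contradiction (≤-trans above (choose-monoˡ-≤ r k≤K)) (<⇒≱ Kᶜ<e)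
      ... | no  k≰K = ≰⇒> k≰K
      d≤ : d ≤ k′ choose r′
      d≤ = ≤-trans (∸-monoʳ-≤ (k choose r) (<⇒≤ below)) (≤-reflexive (m+n∸n≡m (k′ choose r′) (k′ choose r)))
      dk≤rN : d * k ≤ r * k choose r
      dk≤rN = ≤-trans (*-monoˡ-≤ k d≤) (≤-reflexive (trans (*-comm (k′ choose r′) k)
                (trans (sym (choose-absorption k′ r′)) (*-comm (k choose r) r))))
      sparse-G : Σ (RGraph r k) λ G → Sparse p G × numEdges G ≡ d
      sparse-G = sparse-graph-exists r≤k K<k dk≤rN
      G = proj₁ sparse-G
      complement-edges : numEdges (complement G) ≡ e
      complement-edges = begin
        numEdges (complement G)                   ≡⟨ m+n∸n≡m _ d ⟨
        numEdges (complement G) + d ∸ d           ≡⟨ cong (λ x → numEdges (complement G) + x ∸ d) (proj₂ (proj₂ sparse-G)) ⟨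
        numEdges (complement G) + numEdges G ∸ d  ≡⟨ cong (_∸ d) (numEdges-complement G) ⟩
        k choose r ∸ d                            ≡⟨ m∸[m∸n]≡n above ⟩
        e                                         ∎
        where open ≡-Reasoning

  sparse-complement-eventually : ∀ p r D → 0 < r →
    ∃ λ n₀ → ∀ n → n₀ ≤ n → ∀ e → n C r ≤ e * D → e ≤ n C r →
      ∃ λ k → k ≤ n × Σ (RGraph r k) λ G → Sparse p G × numEdges (complement G) ≡ e
  sparse-complement-eventually p r D 0<r = D * Kᶜ + r , λ n n₀≤n e N≤eD e≤N →
    sparse-complement-exists p r 0<r (Kᶜ<e n n₀≤n e N≤eD) (subst (e ≤_) (sym (choose≡C n r)) e≤N)
    where
    Kᶜ = sparseThreshold p r choose r
    Kᶜ<e : ∀ n → D * Kᶜ + r ≤ n → ∀ e → n C r ≤ e * D → Kᶜ < e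
    Kᶜ<e n n₀≤n e N≤eD = *-cancelˡ-< D Kᶜ e (begin-strict
      D * Kᶜ                 <⟨ <-choose-+ (D * Kᶜ) 0<r ⟩
      (D * Kᶜ + r) choose r  ≤⟨ choose-monoˡ-≤ r n₀≤n ⟩
      n choose r             ≡⟨ choose≡C n r ⟩
      n C r                  ≤⟨ N≤eD ⟩
      e * D                  ≡⟨ *-comm e D ⟩
      D * e                  ∎)
      where open ≤-Reasoning


open SparseComplements using (positive⇒bounded-inverse; sparse-complement-eventually)

open import Data.Nat using (ℕ; _≤_)
open import Data.Nat.Combinatorics using (_C_)
open import Data.Integer using (+_)
open import Data.Rational using (ℚ; _/_; 0ℚ; 1ℚ; _*_) renaming (_≤_ to _≤ℚ_; _<_ to _<ℚ_)
open import Data.Product using (Σ; ∃; _×_)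
open import Relation.Binary.PropositionalEquality using (_≡_)
open import Data.Nat using (z≤n; s≤s)
open import Data.Nat.Properties using (≤-trans)
open import Data.Product using (_,_)

lemma2p3 : (p r : ℕ) → 2 ≤ p → 2 ≤ r → (c : ℚ) → 0ℚ <ℚ c → c ≤ℚ 1ℚ →
  ∃ λ (n₀ : ℕ) → ∀ (n : ℕ) → n₀ ≤ n → ∀ (e : ℕ) →
    c * ((+ (n C r)) / 1) ≤ℚ ((+ e) / 1) → e ≤ n C r →
    ∃ λ (k : ℕ) → k ≤ n × Σ (RGraph r k) (λ G → Sparse p G × numEdges (complement G) ≡ e)
lemma2p3 p r _ 2≤r c 0<c _ with positive⇒bounded-inverse c 0<c
... | D , cm≤e⇒m≤eD with sparse-complement-eventually p r D (≤-trans (s≤s z≤n) 2≤r)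
...   | n₀ , complements = n₀ , λ n n₀≤n e cN≤e → complements n n₀≤n e (cm≤e⇒m≤eD (n C r) e cN≤e)
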